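{- Let $s,k$ be positive integers and let $x$ be a positive odd integer with $x>2s$. Then $x\in L(s,k)$ if and only if $x-2t\in L(s,k)$ for all integers $t$ with $s\le t\le s+k$. Likewise, $x\in R(s,k)$ if and only if $x-2t\in R(s,k)$ for all integers $t$ with $s\le t\le s+k$.
   Context: For positive integers $s,k$ define $L(s,k)=\bigcup_{j\ge0}A_j$ and $R(s,k)=\bigcup_{j\ge 0}B_j$, where $A_j=\{2i-1+2sj : i\in\mathbb{Z},\ jk+1\le i\le \lfloor s/2\rfloor\}$ and $B_j=\{2i-1+2sj : i\in\mathbb{Z},\ jk+\lceil (s+k)/2\rceil+1\le i\le s\}$. -}

module Defs where

open import Data.Nat as ℕ using (ℕ)
open import Data.Integer using (ℤ; +_; _+_; _-_; _*_; _≤_)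
open import Data.Product using (∃; ∃-syntax; _×_)
open import Relation.Binary.PropositionalEquality using (_≡_)

floorHalf : ℕ → ℕ
floorHalf s = s ℕ./ 2

-- ⌈ (s + k) / 2 ⌉ = ⌊ (s + k + 1) / 2 ⌋
ceilHalf : ℕ → ℕ → ℕ
ceilHalf s k = (s ℕ.+ k ℕ.+ 1) ℕ./ 2

InA : ℕ → ℕ → ℕ → ℤ → Set
InA s k j y = ∃[ i ] ((+ (j ℕ.* k) + + 1 ≤ i) × (i ≤ + floorHalf s)
                     × (y ≡ + 2 * i - + 1 + + 2 * + s * + j))

InB : ℕ → ℕ → ℕ → ℤ → Set
InB s k j y = ∃[ i ] ((+ (j ℕ.* k) + + ceilHalf s k + + 1 ≤ i) × (i ≤ + s)
                     × (y ≡ + 2 * i - + 1 + + 2 * + s * + j))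

InL : ℕ → ℕ → ℤ → Set
InL s k y = ∃[ j ] InA s k j y

InR : ℕ → ℕ → ℤ → Set
InR s k y = ∃[ j ] InB s k j y

OddZ : ℤ → Set
OddZ x = ∃[ m ] (x ≡ + 2 * m + + 1)

module Submission where

-- Write an odd number as 2m + 1.  Then 2i - 1 + 2sj ∈ A_j (resp. B_j) says
-- exactly that m = s·j + a with j·k + c ≤ a < U, where a = i - 1 and
-- (c, U) = (0, ⌊s/2⌋) for L(s,k), (⌈(s+k)/2⌉, s) for R(s,k).  So both sets
-- are "staircases": in every block [s·j, s·j + s) of length s they occupy a
-- window [s·j + j·k + c, s·j + U) whose left end moves right by k per block.
--
-- The whole lemma is a statement about such staircases of naturals
-- (module Staircase): when U ≤ s and m ≥ s, m lies on the staircase iff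
-- m - n does for every n ∈ [s, s + k].  Going down, an element of block
-- j + 1 falls into block j and stays in the window, since the window start
-- of block j + 1 exceeds that of block j by k ≥ n - s.  Going up, only the
-- two extreme shifts n = s and n = s + k are needed: comparing them shows
-- that m - s lies in a block no higher than m - s - k, which pins the
-- offset of m far enough to the right.

open import Defs

module Staircase where

  open import Data.Nat
  open import Data.Nat.Properties
  open import Data.Nat.Tactic.RingSolver using (solve-∀)
  open import Data.Product using (∃-syntax; _×_; _,_)
  open import Data.Empty using (⊥-elim)
  open import Function.Bundles using (_⇔_; mk⇔)
  open import Relation.Binary.PropositionalEquality

  record Stair (c U s k m : ℕ) : Set where
    constructor stair
    field
      level  : ℕ
      offset : ℕ
      above  : level * k + c ≤ offset
      below  : offset < U
      decomp : m ≡ s * level + offset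

  -- If s·j₁ + a₁ = k + s·j₂ + a₂ with a₂ < s and a₁ at least j₁·k, then
  -- j₁ ≤ j₂: a level j₁ > j₂ would put the left side beyond s·j₂ + s + k.
  level-monotone : ∀ {s k j₁ j₂ a₁ a₂} → a₂ < s → j₁ * k ≤ a₁ →
                   s * j₁ + a₁ ≡ k + (s * j₂ + a₂) → j₁ ≤ j₂
  level-monotone {s} {k} {j₁} {j₂} {a₁} {a₂} a₂<s j₁k≤a₁ eq = ≮⇒≥ λ j₂<j₁ →
    <-irrefl refl (begin-strict
      k + (s * j₂ + a₂)  <⟨ +-monoʳ-< k (+-monoʳ-< (s * j₂) a₂<s) ⟩
      k + (s * j₂ + s)   ≡⟨ regroup s j₂ k ⟩
      s * suc j₂ + k     ≤⟨ +-mono-≤ (*-monoʳ-≤ s j₂<j₁) (k≤j₁k j₂<j₁) ⟩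
      s * j₁ + a₁        ≡⟨ eq ⟩
      k + (s * j₂ + a₂)  ∎)
    where
    open ≤-Reasoning
    regroup : ∀ s j k → k + (s * j + s) ≡ s * suc j + k
    regroup = solve-∀
    k≤j₁k : suc j₂ ≤ j₁ → k ≤ a₁
    k≤j₁k j₂<j₁ = ≤-trans (m≤m+n k (j₂ * k)) (≤-trans (*-monoˡ-≤ k j₂<j₁) j₁k≤a₁)

  offset-gap : ∀ {s k j₁ j₂ a₁ a₂} → j₁ ≤ j₂ →
               s * j₁ + a₁ ≡ k + (s * j₂ + a₂) → k + a₂ ≤ a₁
  offset-gap {s} {k} {j₁} {j₂} {a₁} {a₂} j₁≤j₂ eq = +-cancelˡ-≤ (s * j₁) _ _ (begin
    s * j₁ + (k + a₂)  ≤⟨ +-monoˡ-≤ (k + a₂) (*-monoʳ-≤ s j₁≤j₂) ⟩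
    s * j₂ + (k + a₂)  ≡⟨ +-exchange s j₂ k a₂ ⟩
    k + (s * j₂ + a₂)  ≡⟨ sym eq ⟩
    s * j₁ + a₁        ∎)
    where
    open ≤-Reasoning
    +-exchange : ∀ s j k a → s * j + (k + a) ≡ k + (s * j + a)
    +-exchange = solve-∀

  stair-descend : ∀ {c U s k m} n → U ≤ s → s ≤ m → s ≤ n → n ≤ s + k →
                  Stair c U s k m → ∃[ m' ] (m ≡ n + m' × Stair c U s k m')
  stair-descend {s = s} n U≤s s≤m s≤n n≤s+k (stair zero a _ a<U refl) =
    ⊥-elim (<⇒≱ (≤-trans a<U U≤s) (subst (s ≤_) (cong (_+ a) (*-zeroʳ s)) s≤m))
  stair-descend {c} {U} {s} {k} n U≤s s≤m s≤n n≤s+k (stair (suc j) a above a<U refl) =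
    s * j + (a ∸ u) , split , stair j (a ∸ u) above′ (≤-<-trans (m∸n≤m a u) a<U) refl
    where
    open ≤-Reasoning
    u : ℕ
    u = n ∸ s
    u≤k : u ≤ k
    u≤k = subst (u ≤_) (m+n∸m≡n s k) (∸-monoˡ-≤ s n≤s+k)
    -- the window of level j + 1 starts k after that of level j
    u+start≤a : u + (j * k + c) ≤ a
    u+start≤a = begin
      u + (j * k + c)  ≤⟨ +-monoˡ-≤ (j * k + c) u≤k ⟩
      k + (j * k + c)  ≡⟨ sym (+-assoc k (j * k) c) ⟩
      suc j * k + c    ≤⟨ above ⟩
      a                ∎
    above′ : j * k + c ≤ a ∸ u
    above′ = m+n≤o⇒m≤o∸n (j * k + c) (subst (_≤ a) (+-comm u (j * k + c)) u+start≤a)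
    regroup : ∀ s j u b → s * suc j + (u + b) ≡ (s + u) + (s * j + b)
    regroup = solve-∀
    split : s * suc j + a ≡ n + (s * j + (a ∸ u))
    split = begin-equality
      s * suc j + a                ≡⟨ cong (s * suc j +_) (sym (m+[n∸m]≡n (m+n≤o⇒m≤o u u+start≤a))) ⟩
      s * suc j + (u + (a ∸ u))    ≡⟨ regroup s j u (a ∸ u) ⟩
      (s + u) + (s * j + (a ∸ u))  ≡⟨ cong (_+ (s * j + (a ∸ u))) (m+[n∸m]≡n s≤n) ⟩
      n + (s * j + (a ∸ u))        ∎

  stair-ascend : ∀ {c U s k m m₁ m₂} → U ≤ s → m ≡ s + m₁ → m ≡ s + k + m₂ →
                 Stair c U s k m₁ → Stair c U s k m₂ → Stair c U s k m
  stair-ascend {c} {U} {s} {k} U≤s refl eq₂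
    (stair j₁ a₁ above₁ below₁ refl) (stair j₂ a₂ above₂ below₂ refl) =
    stair (suc j₁) a₁ above below₁ lift
    where
    open ≤-Reasoning
    shifted : s * j₁ + a₁ ≡ k + (s * j₂ + a₂)
    shifted = +-cancelˡ-≡ s _ _ (trans eq₂ (+-assoc s k _))
    j₁≤j₂ : j₁ ≤ j₂
    j₁≤j₂ = level-monotone (≤-trans below₂ U≤s)
              (m+n≤o⇒m≤o (j₁ * k) above₁) shifted
    above : suc j₁ * k + c ≤ a₁
    above = begin
      suc j₁ * k + c   ≡⟨ +-assoc k (j₁ * k) c ⟩
      k + (j₁ * k + c) ≤⟨ +-monoʳ-≤ k (+-monoˡ-≤ c (*-monoˡ-≤ k j₁≤j₂)) ⟩
      k + (j₂ * k + c) ≤⟨ +-monoʳ-≤ k above₂ ⟩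
      k + a₂           ≤⟨ offset-gap {s} {k} j₁≤j₂ shifted ⟩
      a₁               ∎
    lift : s + (s * j₁ + a₁) ≡ s * suc j₁ + a₁
    lift = trans (sym (+-assoc s (s * j₁) a₁)) (cong (_+ a₁) (sym (*-suc s j₁)))

  stair-periodic : ∀ {c U s k m} → U ≤ s → s ≤ m →
    Stair c U s k m ⇔
    (∀ n → s ≤ n → n ≤ s + k → ∃[ m' ] (m ≡ n + m' × Stair c U s k m'))
  stair-periodic {c} {U} {s} {k} {m} U≤s s≤m = mk⇔
    (λ st n s≤n n≤s+k → stair-descend n U≤s s≤m s≤n n≤s+k st)
    (λ shifts → ascend (shifts s ≤-refl (m≤m+n s k)) (shifts (s + k) (m≤m+n s k) ≤-refl))
    where
    ascend : ∃[ m₁ ] (m ≡ s + m₁ × Stair c U s k m₁) →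
             ∃[ m₂ ] (m ≡ s + k + m₂ × Stair c U s k m₂) → Stair c U s k m
    ascend (_ , eq₁ , st₁) (_ , eq₂ , st₂) = stair-ascend U≤s eq₁ eq₂ st₁ st₂

module OddEncoding where

  open import Data.Nat as ℕ using (ℕ; zero; suc)
  import Data.Nat.Properties as ℕ
  open import Data.Integer using (ℤ; +_; _+_; _-_; _*_; _≤_; _<_; +≤+; -_)
  open import Data.Integer.Properties using (pos-*; +-injective; i<j⇒i≤pred[j]; *-cancelˡ-≤-pos)
  import Data.Integer.Tactic.RingSolver as ℤ-Solver
  open import Data.Product using (∃-syntax; _×_; _,_)
  open import Data.Empty using (⊥-elim)
  open import Function.Bundles using (_⇔_; mk⇔; Equivalence)
  import Function.Properties.Equivalence as ⇔
  open import Relation.Binary.PropositionalEquality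
  open Staircase

  odd : ℕ → ℤ
  odd m = + 2 * + m + + 1

  odd-as-ℕ : ∀ m → odd m ≡ + (2 ℕ.* m ℕ.+ 1)
  odd-as-ℕ m = cong (_+ + 1) (sym (pos-* 2 m))

  odd-injective : ∀ {m n} → odd m ≡ odd n → m ≡ n
  odd-injective {m} {n} eq = ℕ.*-cancelˡ-≡ m n 2 (ℕ.+-cancelʳ-≡ _ _ _
    (+-injective (trans (sym (odd-as-ℕ m)) (trans eq (odd-as-ℕ n)))))

  -- pred (2M + 1) = 2M, written with pred unfolded to -1 + _.
  pred-odd : ∀ M → - + 1 + (+ 2 * M + + 1) ≡ + 2 * M
  pred-odd = ℤ-Solver.solve-∀

  odd-above : ∀ {s x} → OddZ x → + 2 * + s < x → ∃[ m ] (x ≡ odd m × s ℕ.≤ m)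
  odd-above {s} (M , refl) 2s<x
    with *-cancelˡ-≤-pos (+ s) M (+ 2) (subst (+ 2 * + s ≤_) (pred-odd M) (i<j⇒i≤pred[j] 2s<x))
  ... | +≤+ s≤m = _ , refl , s≤m

  odd-shift : ∀ m n m' → (odd m - + 2 * + n ≡ odd m') ⇔ (m ≡ n ℕ.+ m')
  odd-shift m n m' = mk⇔ to from
    where
    subtract : ∀ N M → + 2 * (N + M) + + 1 - + 2 * N ≡ + 2 * M + + 1
    subtract = ℤ-Solver.solve-∀
    add-back : ∀ X N → X - + 2 * N + + 2 * N ≡ X
    add-back = ℤ-Solver.solve-∀
    from : m ≡ n ℕ.+ m' → odd m - + 2 * + n ≡ odd m'
    from refl = subtract (+ n) (+ m')
    to : odd m - + 2 * + n ≡ odd m' → m ≡ n ℕ.+ m'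
    to eq = odd-injective (begin
      odd m                           ≡⟨ sym (add-back (odd m) (+ n)) ⟩
      odd m - + 2 * + n + + 2 * + n   ≡⟨ cong (λ y → y + + 2 * + n) eq ⟩
      odd m' + + 2 * + n              ≡⟨ cong (_+ + 2 * + n) (sym (subtract (+ n) (+ m'))) ⟩
      odd (n ℕ.+ m') - + 2 * + n + + 2 * + n   ≡⟨ add-back (odd (n ℕ.+ m')) (+ n) ⟩
      odd (n ℕ.+ m')                  ∎)
      where open ≡-Reasoning

  -- 2i - 1 + 2sj with lo < i ≤ U; for lo = j·k (+ c) this is A_j (B_j).
  Block : (lo U s j : ℕ) → ℤ → Set
  Block lo U s j y = ∃[ i ] ((+ lo + + 1 ≤ i) × (i ≤ + U) × (y ≡ + 2 * i - + 1 + + 2 * + s * + j))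

  block-element : ∀ s j a → + 2 * + suc a - + 1 + + 2 * + s * + j ≡ odd (s ℕ.* j ℕ.+ a)
  block-element s j a = trans (expand (+ s) (+ j) (+ a))
                              (cong (λ sj → + 2 * (sj + + a) + + 1) (sym (pos-* s j)))
    where
    expand : ∀ S J A → + 2 * (+ 1 + A) - + 1 + + 2 * S * J ≡ + 2 * (S * J + A) + + 1
    expand = ℤ-Solver.solve-∀

  block⇔ : ∀ {lo U s j y} →
           Block lo U s j y ⇔ (∃[ a ] (lo ℕ.≤ a × a ℕ.< U × y ≡ odd (s ℕ.* j ℕ.+ a)))
  block⇔ {lo} {U} {s} {j} {y} = mk⇔ to from
    where
    to : Block lo U s j y → ∃[ a ] (lo ℕ.≤ a × a ℕ.< U × y ≡ odd (s ℕ.* j ℕ.+ a))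
    to (+ zero , +≤+ lo+1≤0 , _) = ⊥-elim (ℕ.n≮0 (subst (ℕ._≤ 0) (ℕ.+-comm lo 1) lo+1≤0))
    to (+ suc a , +≤+ lo+1≤i , +≤+ a<U , eq) =
      a , ℕ.≤-pred (subst (ℕ._≤ suc a) (ℕ.+-comm lo 1) lo+1≤i) , a<U , trans eq (block-element s j a)
    from : ∃[ a ] (lo ℕ.≤ a × a ℕ.< U × y ≡ odd (s ℕ.* j ℕ.+ a)) → Block lo U s j y
    from (a , lo≤a , a<U , eq) =
      + suc a , +≤+ (subst (ℕ._≤ suc a) (ℕ.+-comm 1 lo) (ℕ.s≤s lo≤a)) , +≤+ a<U ,
      trans eq (sym (block-element s j a))

  OddStair : (c U s k : ℕ) → ℤ → Set
  OddStair c U s k y = ∃[ m ] (y ≡ odd m × Stair c U s k m)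

  stair-union : ∀ {c U s k y} →
    (∃[ j ] Block (j ℕ.* k ℕ.+ c) U s j y) ⇔ OddStair c U s k y
  stair-union {c} {U} {s} {k} {y} = mk⇔ to from
    where
    to : ∃[ j ] Block (j ℕ.* k ℕ.+ c) U s j y → OddStair c U s k y
    to (j , b) with Equivalence.to (block⇔ {U = U} {s} {j}) b
    ... | a , above , below , eq = s ℕ.* j ℕ.+ a , eq , stair j a above below refl
    from : OddStair c U s k y → ∃[ j ] Block (j ℕ.* k ℕ.+ c) U s j y
    from (_ , eq , stair j a above below refl) =
      j , Equivalence.from (block⇔ {U = U} {s} {j}) (a , above , below , eq)

  -- L(s,k) is the staircase with window [j·k, ⌊s/2⌋); A_j has lower bound
  -- j·k, which stair-union writes as j·k + 0.
  L-as-stair : ∀ s k y → InL s k y ⇔ OddStair 0 (floorHalf s) s k y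
  L-as-stair s k y = ⇔.trans (mk⇔ pad unpad) stair-union
    where
    Blocks : (ℕ → ℕ) → Set
    Blocks lo = ∃[ j ] Block (lo j) (floorHalf s) s j y
    pad : Blocks (λ j → j ℕ.* k) → Blocks (λ j → j ℕ.* k ℕ.+ 0)
    pad (j , b) = j , subst (λ lo → Block lo (floorHalf s) s j y) (sym (ℕ.+-identityʳ (j ℕ.* k))) b
    unpad : Blocks (λ j → j ℕ.* k ℕ.+ 0) → Blocks (λ j → j ℕ.* k)
    unpad (j , b) = j , subst (λ lo → Block lo (floorHalf s) s j y) (ℕ.+-identityʳ (j ℕ.* k)) b

  R-as-stair : ∀ s k y → InR s k y ⇔ OddStair (ceilHalf s k) s s k y
  R-as-stair s k y = stair-union

  odd-periodic : ∀ (In : ℤ → Set) {c U s k m} → U ℕ.≤ s → (∀ y → In y ⇔ OddStair c U s k y) →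
    s ℕ.≤ m → In (odd m) ⇔ ((t : ℤ) → + s ≤ t → t ≤ + s + + k → In (odd m - + 2 * t))
  odd-periodic In {c} {U} {s} {k} {m} U≤s char s≤m = mk⇔ forward backward
    where
    periodic : Stair c U s k m ⇔
               (∀ n → s ℕ.≤ n → n ℕ.≤ s ℕ.+ k → ∃[ m' ] (m ≡ n ℕ.+ m' × Stair c U s k m'))
    periodic = stair-periodic U≤s s≤m
    on-odd : In (odd m) ⇔ Stair c U s k m
    on-odd = mk⇔
      (λ h → let (_ , eq , st) = Equivalence.to (char _) h
             in subst (Stair c U s k) (sym (odd-injective eq)) st)
      (λ st → Equivalence.from (char _) (m , refl , st))
    shifted : ∀ n → In (odd m - + 2 * + n) ⇔ (∃[ m' ] (m ≡ n ℕ.+ m' × Stair c U s k m'))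
    shifted n = mk⇔
      (λ h → let (m' , eq , st) = Equivalence.to (char _) h
             in m' , Equivalence.to (odd-shift m n m') eq , st)
      (λ (m' , eq , st) → Equivalence.from (char _) (m' , Equivalence.from (odd-shift m n m') eq , st))
    forward : In (odd m) → (t : ℤ) → + s ≤ t → t ≤ + s + + k → In (odd m - + 2 * t)
    forward h (+ n) (+≤+ s≤n) (+≤+ n≤s+k) =
      Equivalence.from (shifted n) (Equivalence.to periodic (Equivalence.to on-odd h) n s≤n n≤s+k)
    backward : ((t : ℤ) → + s ≤ t → t ≤ + s + + k → In (odd m - + 2 * t)) → In (odd m)
    backward h = Equivalence.from on-odd (Equivalence.from periodic λ n s≤n n≤s+k →
      Equivalence.to (shifted n) (h (+ n) (+≤+ s≤n) (+≤+ n≤s+k)))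

open OddEncoding using (odd-above; odd-periodic; L-as-stair; R-as-stair)

open import Data.Nat as ℕ using (ℕ)
open import Data.Nat.Properties using (≤-refl)
open import Data.Nat.DivMod using (m/n≤m)
open import Data.Integer using (ℤ; +_; _+_; _-_; _*_; _≤_; _<_)
open import Data.Product using (_×_; _,_)
open import Function.Bundles using (_⇔_)
open import Relation.Binary.PropositionalEquality using (refl)

-- x = 2m + 1 with m ≥ s; L(s,k) and R(s,k) are odd images of staircases
-- with window ends ⌊s/2⌋ ≤ s and s ≤ s respectively.
lemma2p3 : (s k : ℕ) → 1 ℕ.≤ s → 1 ℕ.≤ k → (x : ℤ) → + 0 < x → OddZ x → + 2 * + s < x →
    (InL s k x ⇔ ((t : ℤ) → + s ≤ t → t ≤ + s + + k → InL s k (x - + 2 * t)))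
    × (InR s k x ⇔ ((t : ℤ) → + s ≤ t → t ≤ + s + + k → InR s k (x - + 2 * t)))
lemma2p3 s k _ _ x _ x-odd 2s<x with odd-above x-odd 2s<x
... | m , refl , s≤m =
  odd-periodic (InL s k) (m/n≤m s 2) (L-as-stair s k) s≤m ,
  odd-periodic (InR s k) ≤-refl (R-as-stair s k) s≤m
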